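{- Let $G_i=(V,E_i)$, $i=1,\dots,t$, be graphs on a common vertex set, let $G_\cap=\bigcap_{i=1}^tG_i=(V,\bigcap_{i=1}^tE_i)$, let $c>0$, let $C$ be a clique in $G_\cap$, and let $C'\subseteq C$ be such that $(C',[1,t])$ is a vertex-maximal usually-avg-$c$-isolated temporal clique. Then $C'$ contains every vertex $v\in C$ satisfying $$\sum_{i=1}^t\deg_{G_i}(v)\le t\big(\delta_{G_\cap}(C)+|C'|+1\big).$$
   Context: Graphs are simple and undirected; $\delta_G(C)=\min_{v\in C}\deg_G(v)$. The $G_i$ are viewed as the layers of the temporal graph $(V,E_1,\dots,E_t)$. A temporal clique is a pair $(X,[a,b])$ with $X\subseteq V$, $1\le a\le b\le t$, such that $X$ is a clique in every $G_i$, $i\in[a,b]$. For $v\in A\subseteq V$, $\mathrm{outdeg}_{G}(v,A)$ is the number of edges of $G$ with one endpoint $v$ and the other outside $A$. A temporal clique $(X,[a,b])$ is usually-avg-$c$-isolated if $\sum_{i=a}^b\sum_{v\in X}\mathrm{outdeg}_{G_i}(v,X)<c|X|(b+1-a)$. A usually-avg-$c$-isolated temporal clique $(X,[a,b])$ is vertex-maximal if there is no usually-avg-$c$-isolated temporal clique $(X',[a,b])$ with $X'\supsetneq X$.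
   Formalization: The parameter c ranges over the positive rationals. -}

module Defs where

open import Data.Nat using (ℕ; zero; suc; _+_; _*_; _∸_; _≤_; _⊓_)
open import Data.Bool using (Bool; true; false; if_then_else_; _∧_)
open import Data.Fin using (Fin)
open import Data.Fin.Subset using (Subset; _∈_; _⊆_; _⊂_; ∣_∣)
open import Data.Vec using (lookup)
open import Data.List using (List; []; _∷_; map; filter)
open import Data.Nat.ListAction using (sum)
open import Data.List.Base using (allFin)
open import Data.Product using (_×_; ∃)
open import Relation.Binary.PropositionalEquality using (_≡_; _≢_)
open import Relation.Nullary using (¬_)
open import Data.Bool.Properties using (T?)
open import Data.Integer using (+_)
open import Data.Rational using (ℚ; _/_) renaming (_<_ to _<ℚ_; _*_ to _*ℚ_)

Graph : ℕ → Set
Graph n = Fin n → Fin n → Bool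

Simple : {n : ℕ} → Graph n → Set
Simple G = (∀ u v → G u v ≡ G v u) × (∀ v → G v v ≡ false)

-- A temporal graph: layers G 1, ..., G t (index 0 and indices > t are unused).
Layers : ℕ → Set
Layers n = ℕ → Graph n

-- Sum of f i over i = a, a+1, ..., b  (empty, i.e. 0, if b < a).
sumFromTo : ℕ → ℕ → (ℕ → ℕ) → ℕ
sumFromTo a b f = go (suc b ∸ a) a
  where
  go : ℕ → ℕ → ℕ
  go zero    i = 0
  go (suc k) i = f i + go k (suc i)

allFromTo : ℕ → ℕ → (ℕ → Bool) → Bool
allFromTo a b p = go (suc b ∸ a) a
  where
  go : ℕ → ℕ → Bool
  go zero    i = true
  go (suc k) i = p i ∧ go k (suc i)

sumV : {n : ℕ} → (Fin n → ℕ) → ℕ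
sumV f = sum (map f (allFin _))

sumOver : {n : ℕ} → Subset n → (Fin n → ℕ) → ℕ
sumOver A f = sumV (λ v → if lookup A v then f v else 0)

deg : {n : ℕ} → Graph n → Fin n → ℕ
deg G v = sumV (λ u → if G v u then 1 else 0)

outdeg : {n : ℕ} → Graph n → Fin n → Subset n → ℕ
outdeg G v A = sumV (λ u → if lookup A u then 0 else (if G v u then 1 else 0))

-- minimum of a list (0 for the empty list; only used for nonempty lists)
minList : List ℕ → ℕ
minList []           = 0
minList (x ∷ [])     = x
minList (x ∷ y ∷ xs) = x ⊓ minList (y ∷ xs)

δ : {n : ℕ} → Graph n → Subset n → ℕ
δ G C = minList (map (deg G) (filter (λ v → T? (lookup C v)) (allFin _)))

intersection : {n : ℕ} → ℕ → Layers n → Graph n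
intersection t G u v = allFromTo 1 t (λ i → G i u v)

IsClique : {n : ℕ} → Graph n → Subset n → Set
IsClique G X = ∀ u v → u ∈ X → v ∈ X → u ≢ v → G u v ≡ true

TemporalClique : {n : ℕ} → ℕ → Layers n → Subset n → ℕ → ℕ → Set
TemporalClique t G X a b =
  (1 ≤ a) × (a ≤ b) × (b ≤ t) × (∀ i → a ≤ i → i ≤ b → IsClique (G i) X)

ℕtoℚ : ℕ → ℚ
ℕtoℚ k = (+ k) / 1

UsuallyAvgIsolated : {n : ℕ} → ℚ → ℕ → Layers n → Subset n → ℕ → ℕ → Set
UsuallyAvgIsolated c t G X a b =
  TemporalClique t G X a b ×
  (ℕtoℚ (sumFromTo a b (λ i → sumOver X (λ v → outdeg (G i) v X)))
     <ℚ c *ℚ ℕtoℚ (∣ X ∣ * (suc b ∸ a)))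

VertexMaximal : {n : ℕ} → ℚ → ℕ → Layers n → Subset n → ℕ → ℕ → Set
VertexMaximal c t G X a b =
  UsuallyAvgIsolated c t G X a b ×
  ¬ (∃ λ X' → (X ⊂ X') × UsuallyAvgIsolated c t G X' a b)

module Submission where

-- Suppose v ∉ C' and let X = C' ∪ {v}, k = |C'|; X ⊆ C is again a temporal clique on [1,t].
-- In every layer, adding v to C' removes the k edges between v and C' from the cut and adds
-- the deg(v) − k remaining edges of v, so cut(X) + 2k = cut(C') + deg(v).  Every u ∈ C' has
-- degree at least δ = δ_{G∩}(C) but at most k − 1 neighbours inside C', so
-- cut(C') ≥ k(δ + 1) − k².  Summing over the layers and using the degree bound on v gives
-- k · Σ cut(X) ≤ (k + 1) · Σ cut(C'): the average outgoing degree of X does not exceed that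
-- of C', so X is usually-avg-c-isolated as well, contradicting the vertex-maximality of C'.

open import Defs
open import Data.Nat using (ℕ; suc; _+_; _*_; _≤_)
open import Data.Fin using (Fin)
open import Data.Fin.Subset using (Subset; _∈_; _⊆_; ∣_∣)
open import Data.Rational using (ℚ; 0ℚ) renaming (_<_ to _<ℚ_)

open import Algebra.Properties.CommutativeSemigroup using (interchange)
open import Data.Bool using (Bool; true; false; if_then_else_; _∧_; T)
open import Data.Bool.ListAction using (and)
open import Data.Bool.Properties using (∧-conicalˡ; ∧-conicalʳ; T?)
open import Data.Empty using (⊥-elim)
open import Data.Fin using (zero; suc)
open import Data.Fin.Subset using (_⊂_; _∉_; _∪_; ⁅_⁆; ⊥)
open import Data.Fin.Subset.Properties
  using (_∈?_; ∪-identityʳ; p⊆p∪q; q⊆p∪q; x∈p∪q⁻; x∈⁅x⁆; x∈⁅y⁆⇒x≡y; p⊂q⇒∣p∣<∣q∣)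
import Data.Integer as ℤ
import Data.Integer.Properties as ℤ
open import Data.List using (List; []; _∷_; map; length; iterate; allFin)
import Data.List.Membership.Propositional as List
open import Data.List.Membership.Propositional.Properties using (∈-map⁺; ∈-filter⁺; ∈-allFin)
open import Data.List.Properties using (map-cong; map-tabulate; length-iterate)
open import Data.List.Relation.Unary.Any using (here; there)
open import Data.Nat using (zero; _<_; _∸_; z≤n; s≤s; z<s)
open import Data.Nat.Coprimality using (Coprime)
open import Data.Nat.Divisibility using (∣1⇒≡1)
open import Data.Nat.ListAction using (sum)
open import Data.Nat.Properties
open import Data.Nat.Tactic.RingSolver using (solve-∀)
open import Data.Product using (_×_; _,_; proj₁; proj₂)
open import Data.Rational as ℚ using (mkℚ; toℚᵘ) renaming (_*_ to _*ℚ_)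
open import Data.Rational.Properties using (toℚᵘ-mono-<; toℚᵘ-cancel-<; toℚᵘ-homo-*; toℚᵘ-cong; ↥p/↧p≡p)
import Data.Rational.Unnormalised as ℚᵘ
open import Data.Rational.Unnormalised.Properties using (<-respʳ-≃; *-congˡ; ≃-sym; ≃-trans)
open import Data.Sum using (inj₁; inj₂; [_,_])
open import Data.Unit using (tt)
open import Data.Vec using ([]; _∷_; lookup; here; there)
open import Data.Vec.Properties using ([]=⇒lookup; lookup⇒[]=)
open import Function using (_∘_; id)
open import Function.Bundles using (_⇔_; mk⇔; Equivalence)
open import Relation.Binary.PropositionalEquality
  using (_≡_; refl; sym; trans; cong; cong₂; subst; subst₂; module ≡-Reasoning)
open import Relation.Nullary.Decidable using (decidable-stable)

sum-map-+ : ∀ {A : Set} (f g : A → ℕ) xs →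
  sum (map (λ x → f x + g x) xs) ≡ sum (map f xs) + sum (map g xs)
sum-map-+ f g []       = refl
sum-map-+ f g (x ∷ xs) = trans (cong ((f x + g x) +_) (sum-map-+ f g xs))
  (interchange +-commutativeSemigroup (f x) (g x) _ _)

sum-map-mono : ∀ {A : Set} {f g : A → ℕ} xs →
  (∀ {x} → x List.∈ xs → f x ≤ g x) → sum (map f xs) ≤ sum (map g xs)
sum-map-mono []       f≤g = z≤n
sum-map-mono (x ∷ xs) f≤g = +-mono-≤ (f≤g (here refl)) (sum-map-mono xs (f≤g ∘ there))

sum-map-const : ∀ {A : Set} c (xs : List A) → sum (map (λ _ → c) xs) ≡ length xs * c
sum-map-const c []       = refl
sum-map-const c (x ∷ xs) = cong (c +_) (sum-map-const c xs)

∈-iterate-suc⁻ : ∀ {i j} k → j List.∈ iterate suc i k → i ≤ j × j < i + k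
∈-iterate-suc⁻ {i} (suc k) (here refl) = ≤-refl , m<m+n i z<s
∈-iterate-suc⁻ {i} {j} (suc k) (there j∈) with ∈-iterate-suc⁻ k j∈
... | i<j , j<1+i+k = <⇒≤ i<j , subst (j <_) (sym (+-suc i k)) j<1+i+k

and-iterate-suc : ∀ p i k → and (map p (iterate suc i k)) ≡ true →
  ∀ j → i ≤ j → j < i + k → p j ≡ true
and-iterate-suc p i zero    _ j i≤j j<i+0 =
  ⊥-elim (<-irrefl refl (≤-<-trans i≤j (subst (j <_) (+-identityʳ i) j<i+0)))
and-iterate-suc p i (suc k) h j i≤j j<i+1+k with m≤n⇒m<n∨m≡n i≤j
... | inj₂ refl = ∧-conicalˡ _ _ h
... | inj₁ i<j  = and-iterate-suc p (suc i) k (∧-conicalʳ _ _ h) j i<j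
  (subst (j <_) (+-suc i k) j<i+1+k)

-- The length suc b ∸ a of the range is stuck for symbolic bounds; it is abstracted
-- together with the induction hypothesis so that both sides unfold in step.
sumFromTo-iterate : ∀ f i k → sumFromTo (suc i) (i + k) f ≡ sum (map f (iterate suc (suc i) k))
sumFromTo-iterate f i zero rewrite m+n∸m≡n i 0 = refl
sumFromTo-iterate f i (suc k) with (i + k) ∸ i | m+n∸m≡n i k | sumFromTo-iterate f (suc i) k
... | .k | refl | ih rewrite m+n∸m≡n i (suc k) = cong (f (suc i) +_) ih

allFromTo-iterate : ∀ p i k → allFromTo (suc i) (i + k) p ≡ and (map p (iterate suc (suc i) k))
allFromTo-iterate p i zero rewrite m+n∸m≡n i 0 = refl
allFromTo-iterate p i (suc k) with (i + k) ∸ i | m+n∸m≡n i k | allFromTo-iterate p (suc i) k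
... | .k | refl | ih rewrite m+n∸m≡n i (suc k) = cong (p (suc i) ∧_) ih

layers : ℕ → List ℕ
layers t = iterate suc 1 t

sumFromTo-layers : ∀ t f → sumFromTo 1 t f ≡ sum (map f (layers t))
sumFromTo-layers t f = sumFromTo-iterate f 0 t

∈-layers : ∀ {t i} → i List.∈ layers t → 1 ≤ i × i ≤ t
∈-layers {t} i∈ with ∈-iterate-suc⁻ t i∈
... | 1≤i , i<1+t = 1≤i , ≤-pred i<1+t

sumFromTo-+ : ∀ t (f g : ℕ → ℕ) →
  sumFromTo 1 t (λ i → f i + g i) ≡ sumFromTo 1 t f + sumFromTo 1 t g
sumFromTo-+ t f g = begin
  sumFromTo 1 t (λ i → f i + g i)                ≡⟨ sumFromTo-layers t _ ⟩
  sum (map (λ i → f i + g i) (layers t))         ≡⟨ sum-map-+ f g (layers t) ⟩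
  sum (map f (layers t)) + sum (map g (layers t)) ≡⟨ cong₂ _+_ (sumFromTo-layers t f) (sumFromTo-layers t g) ⟨
  sumFromTo 1 t f + sumFromTo 1 t g              ∎
  where open ≡-Reasoning

sumFromTo-const : ∀ t c → sumFromTo 1 t (λ _ → c) ≡ t * c
sumFromTo-const t c = begin
  sumFromTo 1 t (λ _ → c)        ≡⟨ sumFromTo-layers t _ ⟩
  sum (map (λ _ → c) (layers t)) ≡⟨ sum-map-const c (layers t) ⟩
  length (layers t) * c          ≡⟨ cong (_* c) (length-iterate suc 1 t) ⟩
  t * c                          ∎
  where open ≡-Reasoning

sumFromTo-mono : ∀ t {f g : ℕ → ℕ} → (∀ i → 1 ≤ i → i ≤ t → f i ≤ g i) →
  sumFromTo 1 t f ≤ sumFromTo 1 t g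
sumFromTo-mono t {f} {g} f≤g = subst₂ _≤_ (sym (sumFromTo-layers t f)) (sym (sumFromTo-layers t g))
  (sum-map-mono (layers t) (λ i∈ → f≤g _ (proj₁ (∈-layers i∈)) (proj₂ (∈-layers i∈))))

intersection⇒layer : ∀ {n} t (G : Layers n) {u w i} → intersection t G u w ≡ true →
  1 ≤ i → i ≤ t → G i u w ≡ true
intersection⇒layer t G {u} {w} {i} uw∈G∩ 1≤i i≤t =
  and-iterate-suc (λ j → G j u w) 1 t (trans (sym (allFromTo-iterate _ 0 t)) uw∈G∩) i 1≤i (s≤s i≤t)

module _ {n : ℕ} where

  sumV-+ : (f g : Fin n → ℕ) → sumV (λ w → f w + g w) ≡ sumV f + sumV g
  sumV-+ f g = sum-map-+ f g (allFin n)

  sumV-mono : {f g : Fin n → ℕ} → (∀ w → f w ≤ g w) → sumV f ≤ sumV g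
  sumV-mono f≤g = sum-map-mono (allFin n) (λ {w} _ → f≤g w)

  sumV-cong : {f g : Fin n → ℕ} → (∀ w → f w ≡ g w) → sumV f ≡ sumV g
  sumV-cong f≗g = cong sum (map-cong f≗g (allFin n))

  sumOver-+ : ∀ A (f g : Fin n → ℕ) → sumOver A (λ w → f w + g w) ≡ sumOver A f + sumOver A g
  sumOver-+ A f g = trans (sumV-cong split) (sumV-+ _ _)
    where
    split : ∀ w → (if lookup A w then f w + g w else 0)
                ≡ (if lookup A w then f w else 0) + (if lookup A w then g w else 0)
    split w with lookup A w
    ... | true  = refl
    ... | false = refl

  sumOver-mono : ∀ A {f g : Fin n → ℕ} → (∀ w → w ∈ A → f w ≤ g w) → sumOver A f ≤ sumOver A g
  sumOver-mono A {f} {g} f≤g = sumV-mono pointwise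
    where
    pointwise : ∀ w → (if lookup A w then f w else 0) ≤ (if lookup A w then g w else 0)
    pointwise w with lookup A w in w∈A
    ... | true  = f≤g w (lookup⇒[]= w A w∈A)
    ... | false = z≤n

  sumOver-cong : ∀ A {f g : Fin n → ℕ} → (∀ w → w ∈ A → f w ≡ g w) → sumOver A f ≡ sumOver A g
  sumOver-cong A f≗g = ≤-antisym (sumOver-mono A (λ w w∈A → ≤-reflexive (f≗g w w∈A)))
                                 (sumOver-mono A (λ w w∈A → ≤-reflexive (sym (f≗g w w∈A))))

sumOver-∷ : ∀ {n} b (A : Subset n) (f : Fin (suc n) → ℕ) →
  sumOver (b ∷ A) f ≡ (if b then f zero else 0) + sumOver A (f ∘ suc)
sumOver-∷ b A f = cong (λ xs → (if b then f zero else 0) + sum xs)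
  (trans (map-tabulate suc term) (sym (map-tabulate id (term ∘ suc))))
  where
  term : Fin (suc _) → ℕ
  term w = if lookup (b ∷ A) w then f w else 0

sumOver-const : ∀ {n} (A : Subset n) c → sumOver A (λ _ → c) ≡ ∣ A ∣ * c
sumOver-const []          c = refl
sumOver-const (true ∷ A)  c = trans (sumOver-∷ true A _) (cong (c +_) (sumOver-const A c))
sumOver-const (false ∷ A) c = trans (sumOver-∷ false A _) (sumOver-const A c)

sumOver-1 : ∀ {n} (A : Subset n) → sumOver A (λ _ → 1) ≡ ∣ A ∣
sumOver-1 A = trans (sumOver-const A 1) (*-identityʳ ∣ A ∣)

sumOver-≤-∣∣ : ∀ {n} (A : Subset n) {f : Fin n → ℕ} → (∀ w → f w ≤ 1) → sumOver A f ≤ ∣ A ∣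
sumOver-≤-∣∣ A f≤1 = ≤-trans (sumOver-mono A (λ w _ → f≤1 w)) (≤-reflexive (sumOver-1 A))

sumOver-<-∣∣ : ∀ {n} (A : Subset n) {f : Fin n → ℕ} {u} → (∀ w → f w ≤ 1) → f u ≡ 0 → u ∈ A →
  sumOver A f < ∣ A ∣
sumOver-<-∣∣ (true ∷ A) {f} f≤1 fu≡0 here rewrite sumOver-∷ true A f | fu≡0 =
  s≤s (sumOver-≤-∣∣ A (f≤1 ∘ suc))
sumOver-<-∣∣ (true ∷ A) {f} f≤1 fu≡0 (there u∈A) rewrite sumOver-∷ true A f =
  +-mono-≤-< (f≤1 zero) (sumOver-<-∣∣ A (f≤1 ∘ suc) fu≡0 u∈A)
sumOver-<-∣∣ (false ∷ A) {f} f≤1 fu≡0 (there u∈A) rewrite sumOver-∷ false A f =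
  sumOver-<-∣∣ A (f≤1 ∘ suc) fu≡0 u∈A

sumOver-∪-⁅⁆ : ∀ {n} (A : Subset n) {v} (f : Fin n → ℕ) → v ∉ A →
  sumOver (A ∪ ⁅ v ⁆) f ≡ sumOver A f + f v
sumOver-∪-⁅⁆ (true ∷ A)  {zero}  f v∉A = ⊥-elim (v∉A here)
sumOver-∪-⁅⁆ (false ∷ A) {zero}  f v∉A = begin
  sumOver (true ∷ (A ∪ ⊥)) f           ≡⟨ sumOver-∷ true _ f ⟩
  f zero + sumOver (A ∪ ⊥) (f ∘ suc)    ≡⟨ cong (λ B → f zero + sumOver B (f ∘ suc)) (∪-identityʳ A) ⟩
  f zero + sumOver A (f ∘ suc)          ≡⟨ +-comm (f zero) _ ⟩
  sumOver A (f ∘ suc) + f zero          ≡⟨ cong (_+ f zero) (sumOver-∷ false A f) ⟨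
  sumOver (false ∷ A) f + f zero        ∎
  where open ≡-Reasoning
sumOver-∪-⁅⁆ (true ∷ A)  {suc v} f v∉A = begin
  sumOver (true ∷ (A ∪ ⁅ v ⁆)) f             ≡⟨ sumOver-∷ true _ f ⟩
  f zero + sumOver (A ∪ ⁅ v ⁆) (f ∘ suc)     ≡⟨ cong (f zero +_) (sumOver-∪-⁅⁆ A (f ∘ suc) (v∉A ∘ there)) ⟩
  f zero + (sumOver A (f ∘ suc) + f (suc v)) ≡⟨ +-assoc (f zero) _ _ ⟨
  f zero + sumOver A (f ∘ suc) + f (suc v)   ≡⟨ cong (_+ f (suc v)) (sumOver-∷ true A f) ⟨
  sumOver (true ∷ A) f + f (suc v)           ∎
  where open ≡-Reasoning
sumOver-∪-⁅⁆ (false ∷ A) {suc v} f v∉A = begin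
  sumOver (false ∷ (A ∪ ⁅ v ⁆)) f          ≡⟨ sumOver-∷ false _ f ⟩
  sumOver (A ∪ ⁅ v ⁆) (f ∘ suc)            ≡⟨ sumOver-∪-⁅⁆ A (f ∘ suc) (v∉A ∘ there) ⟩
  sumOver A (f ∘ suc) + f (suc v)          ≡⟨ cong (_+ f (suc v)) (sumOver-∷ false A f) ⟨
  sumOver (false ∷ A) f + f (suc v)        ∎
  where open ≡-Reasoning

A⊂A∪⁅v⁆ : ∀ {n} {A : Subset n} {v} → v ∉ A → A ⊂ A ∪ ⁅ v ⁆
A⊂A∪⁅v⁆ {A = A} {v} v∉A = p⊆p∪q ⁅ v ⁆ , v , q⊆p∪q A ⁅ v ⁆ (x∈⁅x⁆ v) , v∉A

A∪⁅v⁆⊆C : ∀ {n} {A C : Subset n} {v} → A ⊆ C → v ∈ C → A ∪ ⁅ v ⁆ ⊆ C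
A∪⁅v⁆⊆C {A = A} {v = v} A⊆C v∈C u∈A∪⁅v⁆ =
  [ A⊆C , (λ u∈⁅v⁆ → subst (_∈ _) (sym (x∈⁅y⁆⇒x≡y v u∈⁅v⁆)) v∈C) ] (x∈p∪q⁻ A ⁅ v ⁆ u∈A∪⁅v⁆)

𝟙 : Bool → ℕ
𝟙 b = if b then 1 else 0

𝟙≤1 : ∀ b → 𝟙 b ≤ 1
𝟙≤1 true  = ≤-refl
𝟙≤1 false = z≤n

indeg : ∀ {n} → Graph n → Fin n → Subset n → ℕ
indeg G u A = sumOver A (λ w → 𝟙 (G u w))

cut : ∀ {n} → Graph n → Subset n → ℕ
cut G A = sumOver A (λ u → outdeg G u A)

module _ {n : ℕ} (G : Graph n) where

  deg-split : ∀ u A → deg G u ≡ outdeg G u A + indeg G u A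
  deg-split u A = trans (sumV-cong split) (sumV-+ outside inside)
    where
    outside inside : Fin n → ℕ
    outside w = if lookup A w then 0 else 𝟙 (G u w)
    inside  w = if lookup A w then 𝟙 (G u w) else 0
    split : ∀ w → 𝟙 (G u w) ≡ outside w + inside w
    split w with lookup A w
    ... | true  = refl
    ... | false = sym (+-identityʳ _)

  deg-mono : ∀ (H : Graph n) u → (∀ w → G u w ≡ true → H u w ≡ true) → deg G u ≤ deg H u
  deg-mono H u G⊆H = sumV-mono edge
    where
    edge : ∀ w → 𝟙 (G u w) ≤ 𝟙 (H u w)
    edge w with G u w in uw∈G
    ... | false = z≤n
    ... | true  = ≤-reflexive (cong 𝟙 (sym (G⊆H w uw∈G)))

  indeg-complete : ∀ u A → (∀ w → w ∈ A → G u w ≡ true) → indeg G u A ≡ ∣ A ∣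
  indeg-complete u A adj = trans (sumOver-cong A (λ w w∈A → cong 𝟙 (adj w w∈A))) (sumOver-1 A)

  indeg-< : ∀ u A → G u u ≡ false → u ∈ A → indeg G u A < ∣ A ∣
  indeg-< u A uu∉G u∈A = sumOver-<-∣∣ A (λ w → 𝟙≤1 (G u w)) (cong 𝟙 uu∉G) u∈A

  indeg-∪-⁅⁆ : ∀ u A {v} → v ∉ A → indeg G u (A ∪ ⁅ v ⁆) ≡ indeg G u A + 𝟙 (G u v)
  indeg-∪-⁅⁆ u A = sumOver-∪-⁅⁆ A (λ w → 𝟙 (G u w))

  outdeg-∪-⁅⁆ : ∀ u A {v} → v ∉ A → outdeg G u (A ∪ ⁅ v ⁆) + 𝟙 (G u v) ≡ outdeg G u A
  outdeg-∪-⁅⁆ u A {v} v∉A = +-cancelʳ-≡ (indeg G u A) _ _ (begin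
    outdeg G u X + 𝟙 (G u v) + indeg G u A   ≡⟨ +-assoc (outdeg G u X) _ _ ⟩
    outdeg G u X + (𝟙 (G u v) + indeg G u A) ≡⟨ cong (outdeg G u X +_) (+-comm (𝟙 (G u v)) _) ⟩
    outdeg G u X + (indeg G u A + 𝟙 (G u v)) ≡⟨ cong (outdeg G u X +_) (indeg-∪-⁅⁆ u A v∉A) ⟨
    outdeg G u X + indeg G u X                ≡⟨ deg-split u X ⟨
    deg G u                                   ≡⟨ deg-split u A ⟩
    outdeg G u A + indeg G u A                ∎)
    where
    open ≡-Reasoning
    X = A ∪ ⁅ v ⁆

  cut-∪-⁅⁆ : Simple G → ∀ A {v} → v ∉ A → (∀ u → u ∈ A → G v u ≡ true) →
    cut G (A ∪ ⁅ v ⁆) + (∣ A ∣ + ∣ A ∣) ≡ cut G A + deg G v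
  cut-∪-⁅⁆ (symmetric , loopless) A {v} v∉A v-adj = begin
    cut G X + (k + k)                   ≡⟨ cong (_+ (k + k)) (sumOver-∪-⁅⁆ A outX v∉A) ⟩
    sumOver A outX + outX v + (k + k)   ≡⟨ interchange +-commutativeSemigroup (sumOver A outX) (outX v) k k ⟩
    (sumOver A outX + k) + (outX v + k) ≡⟨ cong₂ _+_ members newcomer ⟩
    cut G A + deg G v                   ∎
    where
    open ≡-Reasoning
    X = A ∪ ⁅ v ⁆
    k = ∣ A ∣
    outX : Fin n → ℕ
    outX u = outdeg G u X
    lose-v : ∀ u → u ∈ A → outX u + 1 ≡ outdeg G u A
    lose-v u u∈A = begin
      outX u + 1          ≡⟨ cong (λ b → outX u + 𝟙 b) (trans (symmetric u v) (v-adj u u∈A)) ⟨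
      outX u + 𝟙 (G u v)  ≡⟨ outdeg-∪-⁅⁆ u A v∉A ⟩
      outdeg G u A        ∎
    members : sumOver A outX + k ≡ cut G A
    members = begin
      sumOver A outX + k                  ≡⟨ cong (sumOver A outX +_) (sumOver-1 A) ⟨
      sumOver A outX + sumOver A (λ _ → 1) ≡⟨ sumOver-+ A outX (λ _ → 1) ⟨
      sumOver A (λ u → outX u + 1)        ≡⟨ sumOver-cong A lose-v ⟩
      cut G A                             ∎
    newcomer : outX v + k ≡ deg G v
    newcomer = begin
      outX v + k                          ≡⟨ cong (outX v +_) (indeg-complete v A v-adj) ⟨
      outX v + indeg G v A                ≡⟨ cong (outX v +_) (+-identityʳ _) ⟨
      outX v + (indeg G v A + 0)          ≡⟨ cong (λ b → outX v + (indeg G v A + 𝟙 b)) (loopless v) ⟨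
      outX v + (indeg G v A + 𝟙 (G v v))  ≡⟨ cong (outX v +_) (indeg-∪-⁅⁆ v A v∉A) ⟨
      outX v + indeg G v X                ≡⟨ deg-split v X ⟨
      deg G v                             ∎

  cut-lower-bound : (∀ u → G u u ≡ false) → ∀ A {δ₀} → (∀ u → u ∈ A → δ₀ ≤ deg G u) →
    ∣ A ∣ * suc δ₀ ≤ cut G A + ∣ A ∣ * ∣ A ∣
  cut-lower-bound loopless A {δ₀} δ₀≤deg = begin
    ∣ A ∣ * suc δ₀                           ≡⟨ sumOver-const A (suc δ₀) ⟨
    sumOver A (λ _ → suc δ₀)                 ≤⟨ sumOver-mono A member ⟩
    sumOver A (λ u → outdeg G u A + ∣ A ∣)   ≡⟨ sumOver-+ A _ _ ⟩
    cut G A + sumOver A (λ _ → ∣ A ∣)        ≡⟨ cong (cut G A +_) (sumOver-const A ∣ A ∣) ⟩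
    cut G A + ∣ A ∣ * ∣ A ∣                  ∎
    where
    open ≤-Reasoning
    member : ∀ u → u ∈ A → suc δ₀ ≤ outdeg G u A + ∣ A ∣
    member u u∈A = begin
      suc δ₀                            ≤⟨ s≤s (δ₀≤deg u u∈A) ⟩
      suc (deg G u)                     ≡⟨ cong suc (deg-split u A) ⟩
      suc (outdeg G u A + indeg G u A)  ≡⟨ +-suc (outdeg G u A) _ ⟨
      outdeg G u A + suc (indeg G u A)  ≤⟨ +-monoʳ-≤ (outdeg G u A) (indeg-< u A (loopless u) u∈A) ⟩
      outdeg G u A + ∣ A ∣              ∎

minList-≤ : ∀ {x} xs → x List.∈ xs → minList xs ≤ x
minList-≤ (x ∷ [])     (here refl) = ≤-refl
minList-≤ (x ∷ y ∷ xs) (here refl) = m⊓n≤m x _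
minList-≤ (x ∷ y ∷ xs) (there x∈)  = ≤-trans (m⊓n≤n x _) (minList-≤ (y ∷ xs) x∈)

δ-≤-deg : ∀ {n} (G : Graph n) C {u} → u ∈ C → δ G C ≤ deg G u
δ-≤-deg G C {u} u∈C = minList-≤ _ (∈-map⁺ (deg G)
  (∈-filter⁺ (λ w → T? (lookup C w)) (∈-allFin u) (subst T (sym ([]=⇒lookup u∈C)) tt)))

IsClique-⊆ : ∀ {n} {G : Graph n} {X C} → X ⊆ C → IsClique G C → IsClique G X
IsClique-⊆ X⊆C C-clique u w u∈X w∈X = C-clique u w (X⊆C u∈X) (X⊆C w∈X)

cut-average-≤ : ∀ {a b D t k δ₀} → a + t * (k + k) ≤ b + D → t * (k * suc δ₀) ≤ b + t * (k * k) →
  D ≤ t * (δ₀ + k + 1) → k * a ≤ suc k * b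
cut-average-≤ {a} {b} {D} {t} {k} {δ₀} extend lower deg-bound =
  subst (k * a ≤_) (+-comm (k * b) b) (+-cancelʳ-≤ (tk² + tk²) (k * a) (k * b + b) (begin
    k * a + (tk² + tk²)                  ≡⟨ expand-extend k a t ⟨
    k * (a + t * (k + k))                ≤⟨ *-monoʳ-≤ k extend ⟩
    k * (b + D)                          ≡⟨ *-distribˡ-+ k b D ⟩
    k * b + k * D                        ≤⟨ +-monoʳ-≤ (k * b) (*-monoʳ-≤ k deg-bound) ⟩
    k * b + k * (t * (δ₀ + k + 1))       ≡⟨ cong (k * b +_) (expand-bound k t δ₀) ⟩
    k * b + (t * (k * suc δ₀) + tk²)     ≤⟨ +-monoʳ-≤ (k * b) (+-monoˡ-≤ tk² lower) ⟩
    k * b + (b + tk² + tk²)              ≡⟨ regroup (k * b) b tk² ⟩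
    k * b + b + (tk² + tk²)              ∎))
  where
  open ≤-Reasoning
  tk² = t * (k * k)
  expand-extend : ∀ k a t → k * (a + t * (k + k)) ≡ k * a + (t * (k * k) + t * (k * k))
  expand-extend = solve-∀
  expand-bound : ∀ k t δ₀ → k * (t * (δ₀ + k + 1)) ≡ t * (k * suc δ₀) + t * (k * k)
  expand-bound = solve-∀
  regroup : ∀ x y z → x + (y + z + z) ≡ x + y + (z + z)
  regroup = solve-∀

scaled-< : ∀ {a b k m t D P} → k * a ≤ suc k * b → suc k ≤ m →
  b * D < P * (k * t) → a * D < P * (m * t)
scaled-< {a} {b} {k} {m} {t} {D} {P} ka≤[1+k]b 1+k≤m bD<Pkt =
  <-≤-trans (*-cancelˡ-< k (a * D) (P * (suc k * t)) (begin-strict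
    k * (a * D)             ≡⟨ *-assoc k a D ⟨
    k * a * D               ≤⟨ *-monoˡ-≤ D ka≤[1+k]b ⟩
    suc k * b * D           ≡⟨ *-assoc (suc k) b D ⟩
    suc k * (b * D)         <⟨ *-monoʳ-< (suc k) bD<Pkt ⟩
    suc k * (P * (k * t))   ≡⟨ swap-factors k P t ⟩
    k * (P * (suc k * t))   ∎))
  (*-monoʳ-≤ P (*-monoˡ-≤ t 1+k≤m))
  where
  open ≤-Reasoning
  swap-factors : ∀ k P t → suc k * (P * (k * t)) ≡ k * (P * (suc k * t))
  swap-factors = solve-∀

ℕtoℚ≡mkℚ : ∀ m → ℕtoℚ m ≡ mkℚ (ℤ.+ m) 0 (∣1⇒≡1 ∘ proj₂)
ℕtoℚ≡mkℚ m = ↥p/↧p≡p _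

ℕtoℚ-<-*-ℕtoℚ : ∀ P d .(cop : Coprime P (suc d)) a m →
  (ℕtoℚ a <ℚ mkℚ (ℤ.+ P) d cop *ℚ ℕtoℚ m) ⇔ (a * suc d < P * m)
ℕtoℚ-<-*-ℕtoℚ P d cop a m = mk⇔ to from
  where
  c = mkℚ (ℤ.+ P) d cop
  toℚᵘ-lhs : toℚᵘ (ℕtoℚ a) ≡ ℚᵘ.mkℚᵘ (ℤ.+ a) 0
  toℚᵘ-lhs = cong toℚᵘ (ℕtoℚ≡mkℚ a)
  toℚᵘ-rhs : toℚᵘ (c *ℚ ℕtoℚ m) ℚᵘ.≃ ℚᵘ.mkℚᵘ (ℤ.+ P) d ℚᵘ.* ℚᵘ.mkℚᵘ (ℤ.+ m) 0
  toℚᵘ-rhs = ≃-trans (toℚᵘ-homo-* c (ℕtoℚ m)) (*-congˡ (toℚᵘ-cong (ℕtoℚ≡mkℚ m)))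
  lhs≡ : ℤ.+ a ℤ.* ℤ.+ suc (d * 1) ≡ ℤ.+ (a * suc d)
  lhs≡ = trans (sym (ℤ.pos-* a _)) (cong (λ x → ℤ.+ (a * suc x)) (*-identityʳ d))
  rhs≡ : (ℤ.+ P ℤ.* ℤ.+ m) ℤ.* ℤ.+ 1 ≡ ℤ.+ (P * m)
  rhs≡ = trans (ℤ.*-identityʳ _) (sym (ℤ.pos-* P m))
  to : ℕtoℚ a <ℚ c *ℚ ℕtoℚ m → a * suc d < P * m
  to h with <-respʳ-≃ toℚᵘ-rhs (subst (ℚᵘ._< _) toℚᵘ-lhs (toℚᵘ-mono-< h))
  ... | ℚᵘ.*<* h′ = ℤ.drop‿+<+ (subst₂ ℤ._<_ lhs≡ rhs≡ h′)
  from : a * suc d < P * m → ℕtoℚ a <ℚ c *ℚ ℕtoℚ m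
  from h = toℚᵘ-cancel-< (subst (ℚᵘ._< _) (sym toℚᵘ-lhs)
    (<-respʳ-≃ (≃-sym toℚᵘ-rhs) (ℚᵘ.*<* (subst₂ ℤ._<_ (sym lhs≡) (sym rhs≡) (ℤ.+<+ h)))))

isolation-transfer : ∀ c → 0ℚ <ℚ c → ∀ {a b k m t} → k * a ≤ suc k * b → suc k ≤ m →
  ℕtoℚ b <ℚ c *ℚ ℕtoℚ (k * t) → ℕtoℚ a <ℚ c *ℚ ℕtoℚ (m * t)
isolation-transfer (mkℚ (ℤ.+ P) d cop) _ {a} {b} {k} {m} {t} ka≤[1+k]b 1+k≤m b-isolated =
  Equivalence.from (ℕtoℚ-<-*-ℕtoℚ P d cop a (m * t))
    (scaled-< {t = t} {P = P} ka≤[1+k]b 1+k≤m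
      (Equivalence.to (ℕtoℚ-<-*-ℕtoℚ P d cop b (k * t)) b-isolated))
isolation-transfer (mkℚ ℤ.-[1+ _ ] _ _) (ℚ.*<* ())

module _ {n : ℕ} (t : ℕ) (G : Layers n) where

  intersection-clique : ∀ {C i} → IsClique (intersection t G) C → 1 ≤ i → i ≤ t → IsClique (G i) C
  intersection-clique C-clique 1≤i i≤t u w u∈C w∈C u≢w =
    intersection⇒layer t G (C-clique u w u∈C w∈C u≢w) 1≤i i≤t

  δ-intersection-≤-deg : ∀ C {u i} → u ∈ C → 1 ≤ i → i ≤ t → δ (intersection t G) C ≤ deg (G i) u
  δ-intersection-≤-deg C {u} u∈C 1≤i i≤t = ≤-trans (δ-≤-deg (intersection t G) C u∈C)
    (deg-mono (intersection t G) (G _) u (λ w uw∈G∩ → intersection⇒layer t G uw∈G∩ 1≤i i≤t))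

  clique-temporalClique : ∀ {C X} → IsClique (intersection t G) C → X ⊆ C → 1 ≤ t →
    TemporalClique t G X 1 t
  clique-temporalClique C-clique X⊆C 1≤t = s≤s z≤n , 1≤t , ≤-refl ,
    λ i 1≤i i≤t → IsClique-⊆ X⊆C (intersection-clique C-clique 1≤i i≤t)

  totalCut : Subset n → ℕ
  totalCut X = sumFromTo 1 t (λ i → cut (G i) X)

  totalCut-∪-⁅⁆ : (∀ i → 1 ≤ i → i ≤ t → Simple (G i)) → ∀ A {v} → v ∉ A →
    (∀ i → 1 ≤ i → i ≤ t → ∀ u → u ∈ A → G i v u ≡ true) →
    totalCut (A ∪ ⁅ v ⁆) + t * (∣ A ∣ + ∣ A ∣) ≤ totalCut A + sumFromTo 1 t (λ i → deg (G i) v)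
  totalCut-∪-⁅⁆ simple A {v} v∉A v-adj = begin
    totalCut X + t * (k + k)                        ≡⟨ cong (totalCut X +_) (sumFromTo-const t _) ⟨
    totalCut X + sumFromTo 1 t (λ _ → k + k)        ≡⟨ sumFromTo-+ t _ _ ⟨
    sumFromTo 1 t (λ i → cut (G i) X + (k + k))     ≤⟨ sumFromTo-mono t layer ⟩
    sumFromTo 1 t (λ i → cut (G i) A + deg (G i) v) ≡⟨ sumFromTo-+ t _ _ ⟩
    totalCut A + sumFromTo 1 t (λ i → deg (G i) v)  ∎
    where
    open ≤-Reasoning
    X = A ∪ ⁅ v ⁆
    k = ∣ A ∣
    layer : ∀ i → 1 ≤ i → i ≤ t → cut (G i) X + (k + k) ≤ cut (G i) A + deg (G i) v
    layer i 1≤i i≤t = ≤-reflexive (cut-∪-⁅⁆ (G i) (simple i 1≤i i≤t) A v∉A (v-adj i 1≤i i≤t))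

  totalCut-lower-bound : (∀ i → 1 ≤ i → i ≤ t → Simple (G i)) → ∀ A {δ₀} →
    (∀ i → 1 ≤ i → i ≤ t → ∀ u → u ∈ A → δ₀ ≤ deg (G i) u) →
    t * (∣ A ∣ * suc δ₀) ≤ totalCut A + t * (∣ A ∣ * ∣ A ∣)
  totalCut-lower-bound simple A {δ₀} δ₀≤deg = begin
    t * (k * suc δ₀)                                ≡⟨ sumFromTo-const t _ ⟨
    sumFromTo 1 t (λ _ → k * suc δ₀)                ≤⟨ sumFromTo-mono t layer ⟩
    sumFromTo 1 t (λ i → cut (G i) A + k * k)       ≡⟨ sumFromTo-+ t _ _ ⟩
    totalCut A + sumFromTo 1 t (λ _ → k * k)        ≡⟨ cong (totalCut A +_) (sumFromTo-const t _) ⟩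
    totalCut A + t * (k * k)                        ∎
    where
    open ≤-Reasoning
    k = ∣ A ∣
    layer : ∀ i → 1 ≤ i → i ≤ t → k * suc δ₀ ≤ cut (G i) A + k * k
    layer i 1≤i i≤t = cut-lower-bound (G i) (proj₂ (simple i 1≤i i≤t)) A (δ₀≤deg i 1≤i i≤t)

  insert-isolated : (∀ i → 1 ≤ i → i ≤ t → Simple (G i)) → ∀ c → 0ℚ <ℚ c →
    ∀ {C A v} → IsClique (intersection t G) C → A ⊆ C → v ∈ C → v ∉ A →
    sumFromTo 1 t (λ i → deg (G i) v) ≤ t * (δ (intersection t G) C + ∣ A ∣ + 1) →
    ℕtoℚ (totalCut A) <ℚ c *ℚ ℕtoℚ (∣ A ∣ * t) →
    ℕtoℚ (totalCut (A ∪ ⁅ v ⁆)) <ℚ c *ℚ ℕtoℚ (∣ A ∪ ⁅ v ⁆ ∣ * t)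
  insert-isolated simple c 0<c {C} {A} {v} C-clique A⊆C v∈C v∉A deg-bound A-isolated =
    isolation-transfer c 0<c {totalCut (A ∪ ⁅ v ⁆)} {totalCut A} {∣ A ∣} {∣ A ∪ ⁅ v ⁆ ∣} {t}
      (cut-average-≤ {t = t} {k = ∣ A ∣} {δ₀ = δ (intersection t G) C} extend lower deg-bound)
      (p⊂q⇒∣p∣<∣q∣ (A⊂A∪⁅v⁆ v∉A)) A-isolated
    where
    v-adj : ∀ i → 1 ≤ i → i ≤ t → ∀ u → u ∈ A → G i v u ≡ true
    v-adj i 1≤i i≤t u u∈A =
      intersection-clique C-clique 1≤i i≤t v u v∈C (A⊆C u∈A) (λ { refl → v∉A u∈A })
    extend = totalCut-∪-⁅⁆ simple A v∉A v-adj
    lower = totalCut-lower-bound simple A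
      (λ i 1≤i i≤t u u∈A → δ-intersection-≤-deg C (A⊆C u∈A) 1≤i i≤t)

lemma3 : {n : ℕ} (t : ℕ) (G : Layers n) →
    (∀ i → 1 ≤ i → i ≤ t → Simple (G i)) →
    (c : ℚ) → 0ℚ <ℚ c →
    (C C' : Subset n) →
    IsClique (intersection t G) C →
    C' ⊆ C →
    VertexMaximal c t G C' 1 t →
    (v : Fin n) → v ∈ C →
    sumFromTo 1 t (λ i → deg (G i) v)
      ≤ t * (δ (intersection t G) C + ∣ C' ∣ + 1) →
    v ∈ C'
lemma3 t G simple c 0<c C C' C-clique C'⊆C ((C'-temporal , C'-isolated) , maximal) v v∈C deg-bound =
  decidable-stable (v ∈? C') λ v∉C' →
    maximal (C' ∪ ⁅ v ⁆ , A⊂A∪⁅v⁆ v∉C' ,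
             clique-temporalClique t G C-clique (A∪⁅v⁆⊆C C'⊆C v∈C) (proj₁ (proj₂ C'-temporal)) ,
             insert-isolated t G simple c 0<c C-clique C'⊆C v∈C v∉C' deg-bound C'-isolated)
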